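{- Let $a,b\in\mathbb{C}$ with $ab\ne0$ and let $f=(1,a,0,b)$. Then $OR_2\le^{acyc}_{con}\{f,u,u'\}$, where $u=[b/a,1]$ and $u'=[-a^2,1]$.
   Context: Constraint functions are $f:\{0,1\}^k\to\mathbb{C}$; a binary function is written $(f(00),f(01),f(10),f(11))$ and a unary one as $[f(0),f(1)]$; $OR_2=(0,1,1,1)$. A hypergraph is acyclic if repeatedly deleting vertices lying in at most one hyperedge and deleting hyperedges empty or contained in another yields the empty hypergraph. $f\le^{acyc}_{con}\mathcal{G}$ ($f$ of arity $k$ on $x_1,\dots,x_k$) means: there exist $\lambda\ne0$, auxiliary variables $y_1,\dots,y_m$ and finitely many constraints $(g_j,(z^j_1,\dots,z^j_{d_j}))$, $g_j\in\mathcal{G}$, $z^j_\ell\in\{x_1,\dots,x_k,y_1,\dots,y_m\}$, whose hypergraph (vertices $x$'s and $y$'s, hyperedges $\{z^j_1,\dots,z^j_{d_j}\}$) is acyclic, with $f(x)=\lambda\sum_{y\in\{0,1\}^m}\prod_j g_j(z^j_1,\dots,z^j_{d_j})$ for all $x$. -}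

module Defs where

open import Level using (Level; _⊔_)
open import Algebra.Bundles using (CommutativeRing)
open import Data.Nat as ℕ using (ℕ; _≤_)
open import Data.Bool using (Bool; true; false)
open import Data.Fin using (Fin; zero; suc; _≟_)
open import Data.Fin.Properties using (any?)
open import Data.Fin.Subset using (Subset; _∈_; _⊆_; _-_; ⊤; ⊥)
open import Data.Fin.Subset.Properties using (_∈?_)
open import Data.Vec using (tabulate)
open import Data.Vec.Functional as VF using ()
open import Data.List using (List; []; _∷_; length; lookup; filter; removeAt; map; foldr)
open import Data.Product using (Σ; ∃; _×_; _,_; proj₁; proj₂)
open import Data.Sum using (_⊎_)
open import Relation.Nullary using (¬_)
open import Relation.Nullary.Decidable using (⌊_⌋)
open import Relation.Binary.PropositionalEquality using (_≡_)
open import Relation.Binary.Construct.Closure.ReflexiveTransitive using (Star)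

-- The inverse is a
-- total operation (its value at 0 is irrelevant), so b/a = b * a ⁻¹.

record Field (c ℓ : Level) : Set (Level.suc (c ⊔ ℓ)) where
  field
    commutativeRing : CommutativeRing c ℓ
  open CommutativeRing commutativeRing public
  field
    _⁻¹      : Carrier → Carrier
    ⁻¹-cong  : ∀ {x y} → x ≈ y → x ⁻¹ ≈ y ⁻¹
    0≉1      : ¬ (0# ≈ 1#)
    inverseʳ : ∀ x → ¬ (x ≈ 0#) → x * (x ⁻¹) ≈ 1#

record Hypergraph (N : ℕ) : Set where
  constructor hyp
  field
    vertices : Subset N
    edges    : List (Subset N)
open Hypergraph public

degree : ∀ {N} → Fin N → List (Subset N) → ℕ
degree v es = length (filter (λ e → v ∈? e) es)

data Step {N : ℕ} : Hypergraph N → Hypergraph N → Set where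
  delVertex : ∀ V es (v : Fin N) → v ∈ V → degree v es ≤ 1 →
              Step (hyp V es) (hyp (V - v) (map (λ e → e - v) es))
  delEmpty  : ∀ V es (i : Fin (length es)) → lookup es i ≡ ⊥ →
              Step (hyp V es) (hyp V (removeAt es i))
  delSub    : ∀ V es (i j : Fin (length es)) → ¬ (i ≡ j) →
              lookup es i ⊆ lookup es j →
              Step (hyp V es) (hyp V (removeAt es i))

IsEmptyHypergraph : ∀ {N} → Hypergraph N → Set
IsEmptyHypergraph H = vertices H ≡ ⊥ × edges H ≡ []

Acyclic : ∀ {N} → Hypergraph N → Set
Acyclic H = ∃ λ H' → Star Step H H' × IsEmptyHypergraph H'

module Constraints {c ℓ} (F : Field c ℓ) where
  open Field F using (Carrier; _≈_; _+_; _*_; 0#; 1#)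

  Fn : ℕ → Set c
  Fn k = (Fin k → Bool) → Carrier

  binary : Carrier → Carrier → Carrier → Carrier → Fn 2
  binary f00 f01 f10 f11 x with x zero | x (suc zero)
  ... | false | false = f00
  ... | false | true  = f01
  ... | true  | false = f10
  ... | true  | true  = f11

  unary : Carrier → Carrier → Fn 1
  unary f0 f1 x with x zero
  ... | false = f0
  ... | true  = f1

  OR₂ : Fn 2
  OR₂ = binary 0# 1# 1# 1#

  Family : Set c
  Family = List (Σ ℕ Fn)

  -- a constraint (g_j , (z_1 … z_d)) on the variables Fin N:
  -- g_j is the fn-th member of 𝒢 and scope lists its argument variables
  record Constraint (𝒢 : Family) (N : ℕ) : Set where
    constructor con
    field
      fn    : Fin (length 𝒢)
      scope : Fin (proj₁ (lookup 𝒢 fn)) → Fin N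

  module _ {𝒢 : Family} {N : ℕ} where
    evalC : Constraint 𝒢 N → (Fin N → Bool) → Carrier
    evalC (con i s) σ = proj₂ (lookup 𝒢 i) (λ l → σ (s l))

    edgeOf : Constraint 𝒢 N → Subset N
    edgeOf (con i s) = tabulate (λ v → ⌊ any? (λ l → s l ≟ v) ⌋)

  sumAll : (m : ℕ) → ((Fin m → Bool) → Carrier) → Carrier
  sumAll ℕ.zero    g = g (λ ())
  sumAll (ℕ.suc m) g = sumAll m (λ y → g (false VF.∷ y)) + sumAll m (λ y → g (true VF.∷ y))

  prodList : List Carrier → Carrier
  prodList = foldr _*_ 1#

  -- f ≤^acyc_con 𝒢, for f of arity k on x_1 … x_k.
  -- Variables Fin (k + m): the first k are x_1 … x_k, the last m are y_1 … y_m.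
  ≤acyc : (k : ℕ) → Fn k → Family → Set (c ⊔ ℓ)
  ≤acyc k f 𝒢 =
    Σ Carrier λ λ′ → ¬ (λ′ ≈ 0#) ×
    Σ ℕ λ m → Σ (List (Constraint 𝒢 (k ℕ.+ m))) λ cs →
      Acyclic (hyp ⊤ (map edgeOf cs)) ×
      (∀ (x : Fin k → Bool) →
        f x ≈ λ′ * sumAll m (λ y → prodList (map (λ cj → evalC cj (x VF.++ y)) cs)))

-- Gadget: two inputs x₁, x₂ and one auxiliary y, with constraints u′(y) and
-- f(xᵢ, y) u(xᵢ) for i = 1, 2.  The weight f(x, 1) u(x) equals b for both x,
-- while f(x, 0) u(x) is b/a at x = 0 and vanishes at x = 1.  Summing over y
-- gives b² − a² (b/a)² [x₁ = x₂ = 0] = b² · OR₂(x₁, x₂), and λ = b⁻².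
module Submission where

open import Defs
open import Data.Bool using (Bool; true; false)
open import Data.Fin using (Fin; zero; suc)
open import Data.Fin.Subset using (⊤)
open import Data.List using (List; []; _∷_; map)
open import Data.Nat using (s≤s; z≤n)
open import Data.Product using (_,_)
open import Data.Vec using (here; there)
import Data.Vec.Functional as VF
open import Relation.Nullary using (¬_)
open import Relation.Binary.PropositionalEquality as ≡ using (_≡_)
open import Relation.Binary.Construct.Closure.ReflexiveTransitive using (ε; _◅_)
import Algebra.Properties.Ring as RingProperties
import Algebra.Solver.CommutativeMonoid as CommutativeMonoidSolver
import Relation.Binary.Reasoning.Setoid as SetoidReasoning

module FieldProperties {c ℓ} (F : Field c ℓ) where
  open Field F hiding (zero)
  open SetoidReasoning setoid

  ≉0-factorˡ : ∀ {x y} → ¬ (x * y ≈ 0#) → ¬ (x ≈ 0#)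
  ≉0-factorˡ {x} {y} xy≉0 x≈0 = xy≉0 (trans (*-congʳ x≈0) (zeroˡ y))

  ≉0-factorʳ : ∀ {x y} → ¬ (x * y ≈ 0#) → ¬ (y ≈ 0#)
  ≉0-factorʳ {x} {y} xy≉0 y≈0 = xy≉0 (trans (*-congˡ y≈0) (zeroʳ x))

  inverseˡ : ∀ x → ¬ (x ≈ 0#) → x ⁻¹ * x ≈ 1#
  inverseˡ x x≉0 = trans (*-comm (x ⁻¹) x) (inverseʳ x x≉0)

  ⁻¹-cancelˡ : ∀ {x} → ¬ (x ≈ 0#) → ∀ y → x ⁻¹ * (x * y) ≈ y
  ⁻¹-cancelˡ {x} x≉0 y = begin
    x ⁻¹ * (x * y) ≈⟨ sym (*-assoc (x ⁻¹) x y) ⟩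
    x ⁻¹ * x * y   ≈⟨ *-congʳ (inverseˡ x x≉0) ⟩
    1# * y         ≈⟨ *-identityˡ y ⟩
    y              ∎

  *-≉0 : ∀ {x y} → ¬ (x ≈ 0#) → ¬ (y ≈ 0#) → ¬ (x * y ≈ 0#)
  *-≉0 {x} {y} x≉0 y≉0 xy≈0 = y≉0 (begin
    y              ≈⟨ sym (⁻¹-cancelˡ x≉0 y) ⟩
    x ⁻¹ * (x * y) ≈⟨ *-congˡ xy≈0 ⟩
    x ⁻¹ * 0#      ≈⟨ zeroʳ (x ⁻¹) ⟩
    0#             ∎)

  ⁻¹-≉0 : ∀ {x} → ¬ (x ≈ 0#) → ¬ (x ⁻¹ ≈ 0#)
  ⁻¹-≉0 {x} x≉0 x⁻¹≈0 =
    0≉1 (trans (sym (zeroʳ x)) (trans (*-congˡ (sym x⁻¹≈0)) (inverseʳ x x≉0)))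

module _ {c ℓ} (F : Field c ℓ) where
  open Field F hiding (zero)
  open Constraints F

  binary-pointwise : ∀ f00 f01 f10 f11 (x : Fin 2 → Bool) →
    binary f00 f01 f10 f11 x ≡ binary f00 f01 f10 f11 (x zero VF.∷ x (suc zero) VF.∷ VF.[])
  binary-pointwise f00 f01 f10 f11 x with x zero | x (suc zero)
  ... | false | false = ≡.refl
  ... | false | true  = ≡.refl
  ... | true  | false = ≡.refl
  ... | true  | true  = ≡.refl

  unary-pointwise : ∀ f0 f1 (x : Fin 1 → Bool) → unary f0 f1 x ≡ unary f0 f1 (x zero VF.∷ VF.[])
  unary-pointwise f0 f1 x with x zero
  ... | false = ≡.refl
  ... | true  = ≡.refl

  module Gadget (a b : Carrier) where
    open FieldProperties F
    open RingProperties ring using (-‿distribˡ-*)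
    open CommutativeMonoidSolver *-commutativeMonoid using (solve; _⊜_; _⊕_; id)
    open SetoidReasoning setoid

    f : Fn 2
    f = binary 1# a 0# b

    u u′ : Fn 1
    u  = unary (b * a ⁻¹) 1#
    u′ = unary (- (a * a)) 1#

    𝒢 : Family
    𝒢 = (2 , f) ∷ (1 , u) ∷ (1 , u′) ∷ []

    x₁ x₂ y : Fin 3
    x₁ = zero
    x₂ = suc zero
    y  = suc (suc zero)

    ιf ιu ιu′ : Fin 3
    ιf  = zero
    ιu  = suc zero
    ιu′ = suc (suc zero)

    gadget : List (Constraint 𝒢 3)
    gadget = con ιu′ (y VF.∷ VF.[])
           ∷ con ιf (x₁ VF.∷ y VF.∷ VF.[]) ∷ con ιu (x₁ VF.∷ VF.[])
           ∷ con ιf (x₂ VF.∷ y VF.∷ VF.[]) ∷ con ιu (x₂ VF.∷ VF.[])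
           ∷ []

    -- Edges {y}, {x₁,y}, {x₁}, {x₂,y}, {x₂}: absorb the singletons into the pairs,
    -- delete x₁ and x₂, absorb the two copies of {y}, then delete y and the empty edge.
    gadget-acyclic : Acyclic (hyp ⊤ (map edgeOf gadget))
    gadget-acyclic = _ ,
        (delSub _ _ zero (suc zero) (λ ()) (λ { (there (there here)) → there (there here) })
      ◅ delSub _ _ (suc zero) zero (λ ()) (λ { here → here ; (there (there (there ()))) })
      ◅ delSub _ _ (suc (suc zero)) (suc zero) (λ ()) (λ { (there here) → there here ; (there (there (there ()))) })
      ◅ delVertex _ _ x₁ here (s≤s z≤n)
      ◅ delVertex _ _ x₂ (there here) (s≤s z≤n)
      ◅ delSub _ _ zero (suc zero) (λ ()) (λ { (there (there here)) → there (there here) })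
      ◅ delVertex _ _ y (there (there here)) (s≤s z≤n)
      ◅ delEmpty _ _ zero ≡.refl
      ◅ ε) , ≡.refl , ≡.refl

    weight : Bool → Bool → Carrier
    weight v w = f (v VF.∷ w VF.∷ VF.[]) * u (v VF.∷ VF.[])

    regroup : ∀ s p q r t → s * (p * (q * (r * (t * 1#)))) ≈ s * ((p * q) * (r * t))
    regroup = solve 5 (λ s p q r t →
      s ⊕ (p ⊕ (q ⊕ (r ⊕ (t ⊕ id)))) ⊜ s ⊕ ((p ⊕ q) ⊕ (r ⊕ t))) refl

    gadget-product : ∀ (σ : Fin 3 → Bool) →
      prodList (map (λ cj → evalC cj σ) gadget)
        ≈ u′ (σ y VF.∷ VF.[]) * (weight (σ x₁) (σ y) * weight (σ x₂) (σ y))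
    gadget-product σ = trans (regroup _ _ _ _ _) (reflexive
      (≡.cong₂ _*_ (unaryOn (- (a * a)) y) (≡.cong₂ _*_ (weightOn x₁) (weightOn x₂))))
      where
      unaryOn : ∀ f1 v → unary f1 1# (λ l → σ ((v VF.∷ VF.[]) l)) ≡ unary f1 1# (σ v VF.∷ VF.[])
      unaryOn f1 v = unary-pointwise f1 1# (λ l → σ ((v VF.∷ VF.[]) l))

      weightOn : ∀ v → f (λ l → σ ((v VF.∷ y VF.∷ VF.[]) l)) * u (λ l → σ ((v VF.∷ VF.[]) l))
                         ≡ weight (σ v) (σ y)
      weightOn v = ≡.cong₂ _*_ (binary-pointwise 1# a 0# b (λ l → σ ((v VF.∷ y VF.∷ VF.[]) l)))
                               (unaryOn (b * a ⁻¹) v)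

    module _ (a≉0 : ¬ (a ≈ 0#)) where

      weight-true : ∀ v → weight v true ≈ b
      weight-true false = begin
        a * (b * a ⁻¹) ≈⟨ solve 3 (λ a b a⁻¹ → a ⊕ (b ⊕ a⁻¹) ⊜ b ⊕ (a ⊕ a⁻¹)) refl a b (a ⁻¹) ⟩
        b * (a * a ⁻¹) ≈⟨ *-congˡ (inverseʳ a a≉0) ⟩
        b * 1#         ≈⟨ *-identityʳ b ⟩
        b              ∎
      weight-true true = *-identityʳ b

      a²-weight-false : (a * a) * (weight false false * weight false false) ≈ b * b
      a²-weight-false = begin
        (a * a) * ((1# * (b * a ⁻¹)) * (1# * (b * a ⁻¹)))
          ≈⟨ solve 3 (λ a b a⁻¹ → (a ⊕ a) ⊕ ((id ⊕ (b ⊕ a⁻¹)) ⊕ (id ⊕ (b ⊕ a⁻¹)))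
                                  ⊜ (b ⊕ b) ⊕ ((a ⊕ a⁻¹) ⊕ (a ⊕ a⁻¹))) refl a b (a ⁻¹) ⟩
        (b * b) * ((a * a ⁻¹) * (a * a ⁻¹)) ≈⟨ *-congˡ (*-cong (inverseʳ a a≉0) (inverseʳ a a≉0)) ⟩
        (b * b) * (1# * 1#)                 ≈⟨ *-congˡ (*-identityˡ 1#) ⟩
        (b * b) * 1#                        ≈⟨ *-identityʳ (b * b) ⟩
        b * b                               ∎

      x≈0⇒x+b*b≈b*b*1 : ∀ {x} → x ≈ 0# → x + b * b ≈ (b * b) * 1#
      x≈0⇒x+b*b≈b*b*1 x≈0 = trans (+-congʳ x≈0) (trans (+-identityˡ (b * b)) (sym (*-identityʳ (b * b))))

      y-false-term : ∀ v w →
        u′ (false VF.∷ VF.[]) * (weight v false * weight w false) + b * b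
          ≈ (b * b) * OR₂ (v VF.∷ w VF.∷ VF.[])
      y-false-term false false = begin
        - (a * a) * (weight false false * weight false false) + b * b
          ≈⟨ +-congʳ (sym (-‿distribˡ-* (a * a) _)) ⟩
        - ((a * a) * (weight false false * weight false false)) + b * b
          ≈⟨ +-congʳ (-‿cong a²-weight-false) ⟩
        - (b * b) + b * b ≈⟨ -‿inverseˡ (b * b) ⟩
        0#                ≈⟨ sym (zeroʳ (b * b)) ⟩
        (b * b) * 0#      ∎
      y-false-term false true  = x≈0⇒x+b*b≈b*b*1 (trans (*-congˡ (trans (*-congˡ (zeroˡ 1#)) (zeroʳ _))) (zeroʳ _))
      y-false-term true  false = x≈0⇒x+b*b≈b*b*1 (trans (*-congˡ (trans (*-congʳ (zeroˡ 1#)) (zeroˡ _))) (zeroʳ _))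
      y-false-term true  true  = x≈0⇒x+b*b≈b*b*1 (trans (*-congˡ (trans (*-congʳ (zeroˡ 1#)) (zeroˡ _))) (zeroʳ _))

      gadget-sum : ∀ (x : Fin 2 → Bool) →
        sumAll 1 (λ z → prodList (map (λ cj → evalC cj (x VF.++ z)) gadget))
          ≈ (b * b) * OR₂ (x zero VF.∷ x (suc zero) VF.∷ VF.[])
      gadget-sum x = begin
        sumAll 1 (λ z → prodList (map (λ cj → evalC cj (x VF.++ z)) gadget))
          ≈⟨ +-cong (gadget-product (x VF.++ (false VF.∷ λ ()))) (gadget-product (x VF.++ (true VF.∷ λ ()))) ⟩
        u′ (false VF.∷ VF.[]) * (weight v false * weight w false) + 1# * (weight v true * weight w true)
          ≈⟨ +-congˡ (trans (*-identityˡ _) (*-cong (weight-true v) (weight-true w))) ⟩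
        u′ (false VF.∷ VF.[]) * (weight v false * weight w false) + b * b
          ≈⟨ y-false-term v w ⟩
        (b * b) * OR₂ (v VF.∷ w VF.∷ VF.[]) ∎
        where
        v w : Bool
        v = x zero
        w = x (suc zero)

lemma3p7 : ∀ {c ℓ} (F : Field c ℓ) → let open Field F in let open Constraints F in
    ∀ (a b : Carrier) → ¬ (a * b ≈ 0#) →
      ≤acyc 2 OR₂
        ((2 , binary 1# a 0# b) ∷ (1 , unary (b * a ⁻¹) 1#) ∷ (1 , unary (- (a * a)) 1#) ∷ [])
lemma3p7 F a b ab≉0 =
  (b * b) ⁻¹ , ⁻¹-≉0 b²≉0 , 1 , gadget , gadget-acyclic , represents-OR₂
  where
  open Field F hiding (zero)
  open Constraints F
  open FieldProperties F
  open Gadget F a b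
  open SetoidReasoning setoid

  b²≉0 : ¬ (b * b ≈ 0#)
  b²≉0 = *-≉0 (≉0-factorʳ ab≉0) (≉0-factorʳ ab≉0)

  represents-OR₂ : ∀ x → OR₂ x ≈ (b * b) ⁻¹ * sumAll 1 (λ z → prodList (map (λ cj → evalC cj (x VF.++ z)) gadget))
  represents-OR₂ x = begin
    OR₂ x                                 ≡⟨ binary-pointwise F 0# 1# 1# 1# x ⟩
    OR₂ (x zero VF.∷ x (suc zero) VF.∷ VF.[]) ≈⟨ sym (⁻¹-cancelˡ b²≉0 _) ⟩
    (b * b) ⁻¹ * ((b * b) * OR₂ (x zero VF.∷ x (suc zero) VF.∷ VF.[]))
      ≈⟨ *-congˡ (sym (gadget-sum (≉0-factorˡ ab≉0) x)) ⟩
    (b * b) ⁻¹ * sumAll 1 (λ z → prodList (map (λ cj → evalC cj (x VF.++ z)) gadget)) ∎
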